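{- Let $(G,\alpha,\beta)$ be an oss-graph with $G=(V,A)$, let $G'=(V',A')$ be a loopless directed multigraph with $V\cap V'=\emptyset$, let $v\in V$, $v'\in V'$, and let $(D,\alpha,\beta)$ be the free composition of $(G,\alpha,\beta)$ and $G'$ at $v,v'$. Then $\#\mathrm{UD}^{s,t}_D(\alpha,\beta)=\#\mathrm{UD}^{s,t}_G(\alpha,\beta)\cdot\#\mathrm{UD}(G')$ for all $(s,t)\in S$.
   Context: An oss-graph $(G,\alpha,\beta)$ is a loopless directed multigraph $G=(V,A)$ with two distinguished vertices $\alpha\neq\beta$. A labeling $\mathrm{lab}:A\to\{\oplus,\ominus\}$ is valid if there is an ordered partition $(B_1,\dots,B_t)$ of $V$ such that for each arc $(i,j)$, with $i\in B_{t_i}$, $j\in B_{t_j}$, $\mathrm{lab}((i,j))=\oplus$ iff $t_i\ge t_j$; $\#\mathrm{UD}(G)$ is the number of valid labelings of $G$. Given $\mathrm{lab}$, let $\overleftarrow{G}_{\mathrm{lab}}$ be the multidigraph obtained from $G$ by keeping each arc labeled $\oplus$ and reversing each arc labeled $\ominus$, arcs keeping their labels; $\mathrm{lab}$ is valid iff $\overleftarrow{G}_{\mathrm{lab}}$ has no directed cycle containing an arc labeled $\ominus$. A directed path in $\overleftarrow{G}_{\mathrm{lab}}$ is negative if it contains an arc labeled $\ominus$, positive otherwise. For $x,y\in\{\alpha,\beta\}$, $x\ne y$, and $\mathrm{lab}$ valid, say $\mathrm{lab}$ has type $+$ from $x$ to $y$ if there is at least one path from $x$ to $y$ in $\overleftarrow{G}_{\mathrm{lab}}$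 and all such paths are positive; type $-$ if there is a negative path from $x$ to $y$; type $\varnothing$ if there is no path from $x$ to $y$. Let $S=\{(+,+),(+,\varnothing),(-,\varnothing),(\varnothing,+),(\varnothing,-),(\varnothing,\varnothing)\}$ and for $(s,t)\in S$ let $\#\mathrm{UD}^{s,t}_G(\alpha,\beta)$ be the number of valid labelings of $G$ of type $s$ from $\alpha$ to $\beta$ and type $t$ from $\beta$ to $\alpha$. The free composition at $v,v'$ of $(G,\alpha,\beta)$ and $G'$ is $(D,\alpha,\beta)$ where $D$ is obtained from the disjoint union of $G$ and $G'$ by identifying $v$ and $v'$ into a single vertex. -}

module Defs where

open import Data.Nat using (ℕ; _+_; _≤_)
open import Data.Fin using (Fin; toℕ; splitAt; _≟_)
open import Data.Bool using (Bool; true; false)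
open import Data.Vec using (Vec; lookup)
open import Data.List using (List; []; _∷_; length)
open import Data.List.Relation.Unary.Unique.Propositional using (Unique)
open import Data.List.Membership.Propositional using (_∈_)
open import Data.Product using (Σ; _×_; ∃; _,_)
open import Data.Sum using (_⊎_; inj₁; inj₂)
open import Relation.Nullary using (¬_; yes; no)
open import Relation.Binary.PropositionalEquality using (_≡_; _≢_)
open import Data.Empty using (⊥)
open import Data.Unit using (⊤)
open import Function.Bundles using (_⇔_)

record Graph : Set₁ where
  field
    V   : Set
    m   : ℕ
    src : Fin m → V
    tgt : Fin m → V
open Graph public

Loopless : Graph → Set
Loopless G = ∀ e → src G e ≢ tgt G e

finGraph : (n m : ℕ) → (Fin m → Fin n) → (Fin m → Fin n) → Graph
finGraph n m s t = record { V = Fin n ; m = m ; src = s ; tgt = t }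

-- A labeling: true = ⊕, false = ⊖.
Labeling : Graph → Set
Labeling G = Vec Bool (m G)

Surjective : {A B : Set} → (A → B) → Set
Surjective {A} {B} f = ∀ (b : B) → Σ A λ a → f a ≡ b

-- Valid labeling: an ordered partition (B_1,…,B_t) of V, encoded as a
-- surjective block map V → Fin t, such that arc (i,j) is ⊕ iff t_i ≥ t_j.
Valid : (G : Graph) → Labeling G → Set
Valid G lab = Σ ℕ λ t → Σ (V G → Fin t) λ blk → Surjective blk ×
  (∀ e → (lookup lab e ≡ true) ⇔ (toℕ (blk (tgt G e)) ≤ toℕ (blk (src G e))))

-- Arcs of the reoriented graph G←lab; the Bool records whether the arc is ⊖.
data Step (G : Graph) (lab : Labeling G) : V G → V G → Bool → Set where
  fwd : (e : Fin (m G)) → lookup lab e ≡ true  → Step G lab (src G e) (tgt G e) false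
  bwd : (e : Fin (m G)) → lookup lab e ≡ false → Step G lab (tgt G e) (src G e) true

data Walk (G : Graph) (lab : Labeling G) : V G → V G → Set where
  here : ∀ x → Walk G lab x x
  cons : ∀ {x y z} b → Step G lab x y b → Walk G lab y z → Walk G lab x z

verts : ∀ {G lab x y} → Walk G lab x y → List (V G)
verts (here x) = x ∷ []
verts (cons {x = x} _ _ w) = x ∷ verts w

NegWalk : ∀ {G lab x y} → Walk G lab x y → Set
NegWalk (here _) = ⊥
NegWalk (cons true _ w) = ⊤
NegWalk (cons false _ w) = NegWalk w

Path : (G : Graph) → Labeling G → V G → V G → Set
Path G lab x y = Σ (Walk G lab x y) λ w → Unique (verts w)

Negative : ∀ {G lab x y} → Path G lab x y → Set
Negative (w , _) = NegWalk w

data Ty : Set where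
  plus minus none : Ty

HasType : (G : Graph) → Labeling G → V G → V G → Ty → Set
HasType G lab x y plus  = Path G lab x y × (∀ (p : Path G lab x y) → ¬ Negative p)
HasType G lab x y minus = Σ (Path G lab x y) Negative
HasType G lab x y none  = ¬ Path G lab x y

data S : Ty → Ty → Set where
  pp : S plus plus
  pn : S plus none
  mn : S minus none
  np : S none plus
  nm : S none minus
  nn : S none none

HasCount : (G : Graph) → (Labeling G → Set) → ℕ → Set
HasCount G P k = Σ (List (Labeling G)) λ xs →
  Unique xs × (∀ lab → (lab ∈ xs) ⇔ P lab) × length xs ≡ k

NumUD : Graph → ℕ → Set
NumUD G k = HasCount G (Valid G) k

NumUDst : (G : Graph) → V G → V G → Ty → Ty → ℕ → Set
NumUDst G α β s t k =
  HasCount G (λ lab → Valid G lab × HasType G lab α β s × HasType G lab β α t) k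

-- Free composition at v, v' of G and G' (vertex set Fin n'):
-- vertices V ⊎ (Fin n' ∖ {v'}), with v' identified with v;
-- arcs Fin (m + m'), the first m being those of G, the last m' those of G'.
module _ (G : Graph) (v : V G) {n' : ℕ} (v' : Fin n') where
  CompV : Set
  CompV = V G ⊎ Σ (Fin n') (λ w → w ≢ v')

  embed' : Fin n' → CompV
  embed' w with w ≟ v'
  ... | yes _  = inj₁ v
  ... | no w≢v' = inj₂ (w , w≢v')

  freeComp : (m' : ℕ) → (Fin m' → Fin n') → (Fin m' → Fin n') → Graph
  freeComp m' s' t' = record
    { V = CompV
    ; m = m G + m'
    ; src = λ e → end (src G) s' e
    ; tgt = λ e → end (tgt G) t' e
    }
    where
    end : (Fin (m G) → V G) → (Fin m' → Fin n') → Fin (m G + m') → CompV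
    end f f' e with splitAt (m G) e
    ... | inj₁ a = inj₁ (f a)
    ... | inj₂ a = embed' (f' a)

module Submission where

-- Cutting the free composition D of (G,α,β) and G' at the
-- identified vertex v splits every labeling of D as xs ++ ys, with xs a
-- labeling of G and ys one of G'.  The theorem follows from two facts:
--   * validity splits: lab is valid for D iff xs is valid for G and ys for G'.
--     Validity is recast as the existence of a ranking of the vertices by
--     natural numbers (an ordered partition is the same thing once the ranks
--     are compressed onto an initial segment); rankings restrict along graph
--     maps, and rankings of G and G' glue to one of D after shifting each by
--     the rank of the other graph's copy of the cut vertex;
--   * path types are local: a simple path of D between two vertices of G
--     never enters G', since it would have to leave and re-enter through the
--     cut vertex, visiting it twice; hence paths from α to β in D and in G
--     correspond, preserving negativity.
-- Counting then turns the resulting equivalence into a product of counts.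

open import Defs
open import Data.Bool using (Bool; true; false)
open import Data.Empty using (⊥-elim)
open import Data.Fin using (Fin; toℕ; fromℕ<; punchOut; splitAt; _↑ˡ_; _↑ʳ_; _≟_)
open import Data.Fin.Properties
  using (any?; toℕ<n; toℕ-fromℕ<; toℕ-injective; punchOut-mono-≤; punchOut-cancel-≤;
         splitAt-↑ˡ; splitAt-↑ʳ; splitAt⁻¹-↑ˡ; splitAt⁻¹-↑ʳ)
open import Data.List using (List; []; _∷_; map; length; cartesianProductWith) renaming (_++_ to _++ₗ_)
open import Data.List.Properties using (length-++; length-map)
open import Data.List.Membership.Propositional using (_∈_)
open import Data.List.Membership.Propositional.Properties
  using (∈-cartesianProductWith⁺; ∈-cartesianProductWith⁻)
open import Data.List.Relation.Unary.All as All using ()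
open import Data.List.Relation.Unary.AllPairs using (_∷_)
open import Data.List.Relation.Unary.Any using (here; there)
open import Data.List.Relation.Unary.Unique.Propositional using (Unique)
import Data.List.Relation.Unary.Unique.Propositional.Properties as Unique
open import Data.Nat using (ℕ; zero; suc; _+_; _*_; _≤_; _<_)
open import Data.Nat.Properties
  using (+-comm; +-identityʳ; +-mono-<; +-cancelʳ-≤; +-monoˡ-≤; ≤-antisym; ≤-reflexive)
open import Data.Product using (Σ; _×_; _,_; proj₁; proj₂)
open import Data.Sum using (_⊎_; inj₁; inj₂)
open import Data.Sum.Properties using (inj₁-injective)
open import Data.Unit using (tt)
open import Data.Vec using (Vec; lookup; _++_)
import Data.Vec as Vec
open import Data.Vec.Properties using (lookup-++ˡ; lookup-++ʳ; ++-injective)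
open import Function using (id; _∘_)
open import Function.Bundles using (_⇔_; mk⇔; Equivalence)
open import Function.Related.Propositional using (equivalence)
open import Function.Construct.Symmetry using (⇔-sym)
open import Relation.Nullary using (Dec; yes; no; ¬?)
open import Relation.Binary.PropositionalEquality
  using (_≡_; _≢_; refl; sym; trans; cong; cong₂; subst; subst₂; module ≡-Reasoning)

open Equivalence using (to; from)
module ⇔-Reasoning = Function.Related.Propositional.EquationalReasoning {k = equivalence}

-- A type in which every decidable predicate can be searched exhaustively;
-- needed to detect unused blocks when compressing a ranking.
Searchable : Set → Set₁
Searchable A = (P : A → Set) → (∀ x → Dec (P x)) → Dec (Σ A P)

searchFin : ∀ {k} → Searchable (Fin k)
searchFin P P? = any? P?

search⊎ : ∀ {A B} → Searchable A → Searchable B → Searchable (A ⊎ B)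
search⊎ searchA searchB P P?
  with searchA (P ∘ inj₁) (P? ∘ inj₁) | searchB (P ∘ inj₂) (P? ∘ inj₂)
... | yes (a , p) | _           = yes (inj₁ a , p)
... | no _        | yes (b , p) = yes (inj₂ b , p)
... | no ¬a       | no ¬b       = no λ { (inj₁ a , p) → ¬a (a , p) ; (inj₂ b , p) → ¬b (b , p) }

SameOrder : ∀ {A : Set} {t u} → (A → Fin t) → (A → Fin u) → Set
SameOrder {A} g f = ∀ x y → (toℕ (g x) ≤ toℕ (g y)) ⇔ (toℕ (f x) ≤ toℕ (f y))

Compression : ∀ {A : Set} {t} → (A → Fin t) → Set
Compression {A} f = Σ ℕ λ u → Σ (A → Fin u) λ g → Surjective g × SameOrder g f

-- On a searchable type every map into Fin t has a compression: either every
-- value is attained, or some value k is missed and f factors through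
-- punchOut k, an order embedding into Fin (t - 1).
compress : ∀ {A} → Searchable A → ∀ t (f : A → Fin t) → Compression f
compress search zero f = zero , f , (λ ()) , λ x y → mk⇔ id id
compress search (suc t) f with any? (λ k → ¬? (search (λ x → f x ≡ k) (λ x → f x ≟ k)))
... | no noneMissed = suc t , f , hit , λ x y → mk⇔ id id
  where
  hit : Surjective f
  hit k with search (λ x → f x ≡ k) (λ x → f x ≟ k)
  ... | yes p = p
  ... | no missed = ⊥-elim (noneMissed (k , missed))
... | yes (k , missed) = compressMissing (compress search t (λ x → punchOut (avoids x)))
  where
  avoids : ∀ x → k ≢ f x
  avoids x k≡fx = missed (x , sym k≡fx)

  compressMissing : Compression (λ x → punchOut (avoids x)) → Compression f
  compressMissing (u , g , g-surj , g-order) = u , g , g-surj , λ x y →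
    mk⇔ (λ le → punchOut-cancel-≤ (avoids x) (avoids y) (to (g-order x y) le))
        (λ le → from (g-order x y) (punchOut-mono-≤ (avoids x) (avoids y) le))

-- A valid
-- labeling is one ranked by (the block index of) an ordered partition.
ArcRanked : (G : Graph) → Labeling G → (V G → ℕ) → Fin (m G) → Set
ArcRanked G lab r e = (lookup lab e ≡ true) ⇔ (r (tgt G e) ≤ r (src G e))

Ranks : (G : Graph) → Labeling G → (V G → ℕ) → Set
Ranks G lab r = ∀ e → ArcRanked G lab r e

-- The ranking may be given on a searchable cover B of the
-- vertices (through π), provided every rank value on B is attained by some
-- vertex; this is how a ranking of D is built from rankings of G and G'.
ranks⇒valid : ∀ {G lab B t} → Searchable B → (π : V G → B) (r : B → ℕ) →
  (∀ b → r b < t) → (∀ b → Σ (V G) λ x → r (π x) ≡ r b) →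
  Ranks G lab (r ∘ π) → Valid G lab
ranks⇒valid {G} {lab} {B} {t} search π r bounded attained ranked =
  fromCompression (compress search t rank)
  where
  rank : B → Fin t
  rank b = fromℕ< (bounded b)

  fromCompression : Compression rank → Valid G lab
  fromCompression (u , g , g-surj , g-order) = u , g ∘ π , surj , ranked′
    where
    order : ∀ b c → (toℕ (g b) ≤ toℕ (g c)) ⇔ (r b ≤ r c)
    order b c = begin
      (toℕ (g b) ≤ toℕ (g c))       ∼⟨ g-order b c ⟩
      (toℕ (rank b) ≤ toℕ (rank c)) ≡⟨ cong₂ _≤_ (toℕ-fromℕ< _) (toℕ-fromℕ< _) ⟩
      (r b ≤ r c)                   ∎
      where open ⇔-Reasoning

    sameRank⇒sameBlock : ∀ b c → r b ≡ r c → g b ≡ g c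
    sameRank⇒sameBlock b c eq = toℕ-injective (≤-antisym
      (from (order b c) (≤-reflexive eq)) (from (order c b) (≤-reflexive (sym eq))))

    surj : Surjective (g ∘ π)
    surj k with g-surj k
    ... | b , gb≡k with attained b
    ...   | x , eq = x , trans (sameRank⇒sameBlock (π x) b eq) gb≡k

    ranked′ : Ranks G lab (λ x → toℕ (g (π x)))
    ranked′ e = begin
      (lookup lab e ≡ true)                     ∼⟨ ranked e ⟩
      (r (π (tgt G e)) ≤ r (π (src G e)))       ∼⟨ ⇔-sym (order _ _) ⟩
      (toℕ (g (π (tgt G e))) ≤ toℕ (g (π (src G e)))) ∎
      where open ⇔-Reasoning

record LabelledHom (G : Graph) (lG : Labeling G) (H : Graph) (lH : Labeling H) : Set where
  field
    vmap      : V G → V H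
    amap      : Fin (m G) → Fin (m H)
    src-hom   : ∀ a → src H (amap a) ≡ vmap (src G a)
    tgt-hom   : ∀ a → tgt H (amap a) ≡ vmap (tgt G a)
    label-hom : ∀ a → lookup lH (amap a) ≡ lookup lG a
open LabelledHom

ranked-along : ∀ {G lG H lH} (h : LabelledHom G lG H lH) (rH : V H → ℕ) (rG : V G → ℕ) c →
  (∀ x → rH (vmap h x) ≡ rG x + c) →
  ∀ a → ArcRanked H lH rH (amap h a) ⇔ ArcRanked G lG rG a
ranked-along {G} {lG} {H} {lH} h rH rG c shift a =
  mk⇔ (λ rankedH → begin
         (lookup lG a ≡ true)                  ≡⟨ sym sameLabel ⟩
         (lookup lH (amap h a) ≡ true)         ∼⟨ rankedH ⟩
         (rH (tgt H (amap h a)) ≤ rH (src H (amap h a))) ∼⟨ sameOrder ⟩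
         (rG (tgt G a) ≤ rG (src G a))         ∎)
      (λ rankedG → begin
         (lookup lH (amap h a) ≡ true)         ≡⟨ sameLabel ⟩
         (lookup lG a ≡ true)                  ∼⟨ rankedG ⟩
         (rG (tgt G a) ≤ rG (src G a))         ∼⟨ ⇔-sym sameOrder ⟩
         (rH (tgt H (amap h a)) ≤ rH (src H (amap h a))) ∎)
  where
  open ⇔-Reasoning
  sameLabel : (lookup lH (amap h a) ≡ true) ≡ (lookup lG a ≡ true)
  sameLabel = cong (_≡ true) (label-hom h a)

  shiftAt : ∀ {y x} → y ≡ vmap h x → rH y ≡ rG x + c
  shiftAt {x = x} refl = shift x

  sameOrder : (rH (tgt H (amap h a)) ≤ rH (src H (amap h a))) ⇔ (rG (tgt G a) ≤ rG (src G a))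
  sameOrder = begin
    (rH (tgt H (amap h a)) ≤ rH (src H (amap h a))) ≡⟨ cong₂ _≤_ (shiftAt (tgt-hom h a)) (shiftAt (src-hom h a)) ⟩
    (rG (tgt G a) + c ≤ rG (src G a) + c)           ∼⟨ mk⇔ (+-cancelʳ-≤ c _ _) (+-monoˡ-≤ c) ⟩
    (rG (tgt G a) ≤ rG (src G a))                   ∎

valid-pullback : ∀ {G lG H lH} → Searchable (V G) → LabelledHom G lG H lH →
  Valid H lH → Valid G lG
valid-pullback {G} {lG} search h (t , blk , _ , ranked) =
  ranks⇒valid {lab = lG} search id rG (λ x → toℕ<n (blk (vmap h x))) (λ x → x , refl)
    (λ a → to (ranked-along h (toℕ ∘ blk) rG 0 (λ x → sym (+-identityʳ (rG x))) a) (ranked (amap h a)))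
  where
  rG : V G → ℕ
  rG x = toℕ (blk (vmap h x))

neg-cons : ∀ {G H lG lH} {x y z : V G} {x′ y′ z′ : V H} b
  (s : Step G lG x y b) (w : Walk G lG y z) (s′ : Step H lH x′ y′ b) (w′ : Walk H lH y′ z′) →
  (NegWalk w → NegWalk w′) → NegWalk (cons b s w) → NegWalk (cons b s′ w′)
neg-cons true  _ _ _ _ _    _   = tt
neg-cons false _ _ _ _ rest neg = rest neg

start∈verts : ∀ {G lab x y} (w : Walk G lab x y) → x ∈ verts w
start∈verts (here _)     = here refl
start∈verts (cons _ _ _) = here refl

module _ {G lG H lH} (h : LabelledHom G lG H lH) where

  mapStep : ∀ {x y b} → Step G lG x y b → Step H lH (vmap h x) (vmap h y) b
  mapStep (fwd a p) = subst₂ (λ x y → Step H lH x y false) (src-hom h a) (tgt-hom h a)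
    (fwd (amap h a) (trans (label-hom h a) p))
  mapStep (bwd a p) = subst₂ (λ x y → Step H lH x y true) (tgt-hom h a) (src-hom h a)
    (bwd (amap h a) (trans (label-hom h a) p))

  mapWalk : ∀ {x y} → Walk G lG x y → Walk H lH (vmap h x) (vmap h y)
  mapWalk (here x)     = here (vmap h x)
  mapWalk (cons b s w) = cons b (mapStep s) (mapWalk w)

  verts-mapWalk : ∀ {x y} (w : Walk G lG x y) → verts (mapWalk w) ≡ map (vmap h) (verts w)
  verts-mapWalk (here _)     = refl
  verts-mapWalk (cons _ _ w) = cong (_ ∷_) (verts-mapWalk w)

  neg-mapWalk : ∀ {x y} (w : Walk G lG x y) → NegWalk w → NegWalk (mapWalk w)
  neg-mapWalk (here _)     ()
  neg-mapWalk (cons b s w) = neg-cons b s w (mapStep s) (mapWalk w) (neg-mapWalk w)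

  mapPath : (∀ {x y} → vmap h x ≡ vmap h y → x ≡ y) →
    ∀ {x y} → Path G lG x y → Path H lH (vmap h x) (vmap h y)
  mapPath injective (w , unique) =
    mapWalk w , subst Unique (sym (verts-mapWalk w)) (Unique.map⁺ injective unique)

hasType-transfer : ∀ {G lG H lH} {x y : V G} {x′ y′ : V H}
  (f : Path G lG x y → Path H lH x′ y′) (g : Path H lH x′ y′ → Path G lG x y) →
  (∀ p → Negative p → Negative (f p)) → (∀ q → Negative q → Negative (g q)) →
  ∀ s → HasType G lG x y s → HasType H lH x′ y′ s
hasType-transfer f g f-neg g-neg plus  (p , positive) = f p , λ q neg → positive (g q) (g-neg q neg)
hasType-transfer f g f-neg g-neg minus (p , neg)      = f p , f-neg p neg
hasType-transfer f g f-neg g-neg none  noPath         = noPath ∘ g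

Counted : (A : Set) → (A → Set) → ℕ → Set
Counted A P k = Σ (List A) λ xs → Unique xs × (∀ a → (a ∈ xs) ⇔ P a) × length xs ≡ k

length-cartesianProductWith : ∀ {A B C : Set} (f : A → B → C) xs ys →
  length (cartesianProductWith f xs ys) ≡ length xs * length ys
length-cartesianProductWith f []       ys = refl
length-cartesianProductWith f (x ∷ xs) ys = begin
  length (map (f x) ys ++ₗ cartesianProductWith f xs ys)         ≡⟨ length-++ (map (f x) ys) ⟩
  length (map (f x) ys) + length (cartesianProductWith f xs ys)  ≡⟨ cong₂ _+_ (length-map (f x) ys)
                                                                      (length-cartesianProductWith f xs ys) ⟩
  length ys + length xs * length ys                              ∎
  where open ≡-Reasoning

count-++ : ∀ {A : Set} {m₁ m₂ a b} {P₁ : Vec A m₁ → Set} {P₂ : Vec A m₂ → Set} {P} →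
  Counted (Vec A m₁) P₁ a → Counted (Vec A m₂) P₂ b →
  (∀ xs ys → P (xs ++ ys) ⇔ (P₁ xs × P₂ ys)) → Counted (Vec A (m₁ + m₂)) P (a * b)
count-++ {m₁ = m₁} {P = P} (xss , unique₁ , mem₁ , len₁) (yss , unique₂ , mem₂ , len₂) split =
  pairs , unique , mem , trans (length-cartesianProductWith _++_ xss yss) (cong₂ _*_ len₁ len₂)
  where
  pairs : List (Vec _ (m₁ + _))
  pairs = cartesianProductWith _++_ xss yss

  unique : Unique pairs
  unique = Unique.cartesianProductWith⁺ _++_ (λ {w} {x} eq → ++-injective w x eq) unique₁ unique₂

  mem : ∀ zs → (zs ∈ pairs) ⇔ P zs
  mem zs = mk⇔ inPairs⇒P P⇒inPairs
    where
    inPairs⇒P : zs ∈ pairs → P zs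
    inPairs⇒P zs∈ with ∈-cartesianProductWith⁻ _++_ xss yss zs∈
    ... | xs , ys , xs∈ , ys∈ , refl = from (split xs ys) (to (mem₁ xs) xs∈ , to (mem₂ ys) ys∈)

    P⇒inPairs : P zs → zs ∈ pairs
    P⇒inPairs pz with Vec.splitAt m₁ zs
    ... | xs , ys , refl with to (split xs ys) pz
    ...   | p₁ , p₂ = ∈-cartesianProductWith⁺ _++_ (from (mem₁ xs) p₁) (from (mem₂ ys) p₂)

module FreeComposition (G : Graph) (searchG : Searchable (V G)) (v : V G)
                       {n′ m′ : ℕ} (v′ : Fin n′) (src′ tgt′ : Fin m′ → Fin n′) where

  G′ : Graph
  G′ = finGraph n′ m′ src′ tgt′

  D : Graph
  D = freeComp G v v′ m′ src′ tgt′

  emb : Fin n′ → V D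
  emb = embed' G v v′

  data Arc : Fin (m D) → Set where
    left  : (a : Fin (m G)) → Arc (a ↑ˡ m′)
    right : (a : Fin m′) → Arc (m G ↑ʳ a)

  arc : ∀ e → Arc e
  arc e with splitAt (m G) e in eq
  ... | inj₁ a = subst Arc (splitAt⁻¹-↑ˡ eq) (left a)
  ... | inj₂ a = subst Arc (splitAt⁻¹-↑ʳ eq) (right a)

  ends-left : ∀ a → src D (a ↑ˡ m′) ≡ inj₁ (src G a) × tgt D (a ↑ˡ m′) ≡ inj₁ (tgt G a)
  ends-left a rewrite splitAt-↑ˡ (m G) a m′ = refl , refl

  ends-right : ∀ a → src D (m G ↑ʳ a) ≡ emb (src′ a) × tgt D (m G ↑ʳ a) ≡ emb (tgt′ a)
  ends-right a rewrite splitAt-↑ʳ (m G) m′ a = refl , refl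

  data InG′ : V D → Set where
    cut   : InG′ (inj₁ v)
    inner : ∀ u → InG′ (inj₂ u)

  emb-InG′ : ∀ w → InG′ (emb w)
  emb-InG′ w with w ≟ v′
  ... | yes _   = cut
  ... | no w≢v′ = inner (w , w≢v′)

  module Labelled (xs : Labeling G) (ys : Labeling G′) where

    lab : Labeling D
    lab = xs ++ ys

    fromG : LabelledHom G xs D lab
    fromG = record
      { vmap = inj₁ ; amap = _↑ˡ m′
      ; src-hom = proj₁ ∘ ends-left ; tgt-hom = proj₂ ∘ ends-left
      ; label-hom = lookup-++ˡ xs ys }

    fromG′ : LabelledHom G′ ys D lab
    fromG′ = record
      { vmap = emb ; amap = m G ↑ʳ_
      ; src-hom = proj₁ ∘ ends-right ; tgt-hom = proj₂ ∘ ends-right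
      ; label-hom = lookup-++ʳ xs ys }

    data StepView : V D → V D → Bool → Set where
      stepG  : ∀ {x y b} → Step G xs x y b → StepView (inj₁ x) (inj₁ y) b
      stepG′ : ∀ {x y b} → InG′ x → InG′ y → StepView x y b

    view : ∀ {x y b} → Step D lab x y b → StepView x y b
    view (fwd e p) with arc e
    ... | left a = subst₂ (λ x y → StepView x y false) (sym (src-hom fromG a)) (sym (tgt-hom fromG a))
                     (stepG (fwd a (trans (sym (label-hom fromG a)) p)))
    ... | right a = subst₂ (λ x y → StepView x y false) (sym (src-hom fromG′ a)) (sym (tgt-hom fromG′ a))
                     (stepG′ (emb-InG′ (src′ a)) (emb-InG′ (tgt′ a)))
    view (bwd e p) with arc e
    ... | left a = subst₂ (λ x y → StepView x y true) (sym (tgt-hom fromG a)) (sym (src-hom fromG a))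
                     (stepG (bwd a (trans (sym (label-hom fromG a)) p)))
    ... | right a = subst₂ (λ x y → StepView x y true) (sym (tgt-hom fromG′ a)) (sym (src-hom fromG′ a))
                     (stepG′ (emb-InG′ (tgt′ a)) (emb-InG′ (src′ a)))

    through-cut : ∀ {u y} (w : Walk D lab (inj₂ u) (inj₁ y)) → inj₁ v ∈ verts w
    through-cut (cons b s w) with view s
    ... | stepG′ _ cut       = there (start∈verts w)
    ... | stepG′ _ (inner _) = there (through-cut w)

    lower : ∀ {x y} (w : Walk D lab (inj₁ x) (inj₁ y)) → Unique (verts w) →
      Σ (Walk G xs x y) λ w′ → verts w ≡ map inj₁ (verts w′) × (NegWalk w → NegWalk w′)
    lower (here _) _ = here _ , refl , λ ()
    lower (cons b s w) (fresh ∷ unique) with view s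
    ... | stepG s′ = let w′ , vs , neg = lower w unique in
                     cons b s′ w′ , cong (_ ∷_) vs , neg-cons b s w s′ w′ neg
    ... | stepG′ cut cut       = ⊥-elim (All.lookup fresh (start∈verts w) refl)
    ... | stepG′ cut (inner _) = ⊥-elim (All.lookup fresh (through-cut w) refl)

    lowerPath : ∀ {x y} → Path D lab (inj₁ x) (inj₁ y) → Path G xs x y
    lowerPath (w , unique) = let w′ , vs , _ = lower w unique in w′ , Unique.map⁻ (subst Unique vs unique)

    neg-lowerPath : ∀ {x y} (p : Path D lab (inj₁ x) (inj₁ y)) → Negative p → Negative (lowerPath p)
    neg-lowerPath (w , unique) = proj₂ (proj₂ (lower w unique))

    liftPath : ∀ {x y} → Path G xs x y → Path D lab (inj₁ x) (inj₁ y)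
    liftPath = mapPath fromG inj₁-injective

    neg-liftPath : ∀ {x y} (p : Path G xs x y) → Negative p → Negative (liftPath p)
    neg-liftPath (w , _) = neg-mapWalk fromG w

    sameType : ∀ {x y} s → HasType D lab (inj₁ x) (inj₁ y) s ⇔ HasType G xs x y s
    sameType s = mk⇔ (hasType-transfer lowerPath liftPath neg-lowerPath neg-liftPath s)
                     (hasType-transfer liftPath lowerPath neg-liftPath neg-lowerPath s)

    -- For the converse,
    -- rank a vertex of G by its G-rank plus the G'-rank of v', and a vertex of
    -- G' by its G'-rank plus the G-rank of v; the two agree on the cut vertex.
    glue : Valid G xs → Valid G′ ys → Valid D lab
    glue (t₁ , blk₁ , _ , ranked₁) (t₂ , blk₂ , _ , ranked₂) =
      ranks⇒valid {lab = lab} (search⊎ searchG searchFin) forget rank bounded attained ranked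
      where
      r₁ : V G → ℕ
      r₁ x = toℕ (blk₁ x)
      r₂ : Fin n′ → ℕ
      r₂ w = toℕ (blk₂ w)

      forget : V D → V G ⊎ Fin n′
      forget (inj₁ x)       = inj₁ x
      forget (inj₂ (w , _)) = inj₂ w

      rank : V G ⊎ Fin n′ → ℕ
      rank (inj₁ x) = r₁ x + r₂ v′
      rank (inj₂ w) = r₂ w + r₁ v

      bounded : ∀ b → rank b < t₁ + t₂
      bounded (inj₁ x) = +-mono-< (toℕ<n (blk₁ x)) (toℕ<n (blk₂ v′))
      bounded (inj₂ w) = subst (rank (inj₂ w) <_) (+-comm t₂ t₁) (+-mono-< (toℕ<n (blk₂ w)) (toℕ<n (blk₁ v)))

      rank-emb : ∀ w → rank (forget (emb w)) ≡ r₂ w + r₁ v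
      rank-emb w with w ≟ v′
      ... | yes refl = +-comm (r₁ v) (r₂ v′)
      ... | no _     = refl

      attained : ∀ b → Σ (V D) λ x → rank (forget x) ≡ rank b
      attained (inj₁ x) = inj₁ x , refl
      attained (inj₂ w) = emb w , rank-emb w

      ranked : Ranks D lab (rank ∘ forget)
      ranked e with arc e
      ... | left a  = from (ranked-along fromG (rank ∘ forget) r₁ (r₂ v′) (λ _ → refl) a) (ranked₁ a)
      ... | right a = from (ranked-along fromG′ (rank ∘ forget) r₂ (r₁ v) rank-emb a) (ranked₂ a)

    validSplit : Valid D lab ⇔ (Valid G xs × Valid G′ ys)
    validSplit = mk⇔ (λ valid → valid-pullback searchG fromG valid , valid-pullback searchFin fromG′ valid)
                     (λ (validG , validG′) → glue validG validG′)

    split : ∀ α β s t →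
      (Valid D lab × HasType D lab (inj₁ α) (inj₁ β) s × HasType D lab (inj₁ β) (inj₁ α) t) ⇔
      ((Valid G xs × HasType G xs α β s × HasType G xs β α t) × Valid G′ ys)
    split α β s t = mk⇔
      (λ (valid , type₁ , type₂) →
         (proj₁ (to validSplit valid) , to (sameType s) type₁ , to (sameType t) type₂) , proj₂ (to validSplit valid))
      (λ ((validG , type₁ , type₂) , validG′) →
         from validSplit (validG , validG′) , from (sameType s) type₁ , from (sameType t) type₂)

-- The theorem: the product rule applied to the splitting above.  It holds
-- for every pair of types (s, t).
lemma4 : (n m : ℕ) (src tgt : Fin m → Fin n) (α β : Fin n)
    (n' m' : ℕ) (src' tgt' : Fin m' → Fin n')
    (v : Fin n) (v' : Fin n') →
    Loopless (finGraph n m src tgt) → α ≢ β →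
    Loopless (finGraph n' m' src' tgt') →
    (s t : Ty) → S s t → (a b : ℕ) →
    NumUDst (finGraph n m src tgt) α β s t a →
    NumUD (finGraph n' m' src' tgt') b →
    NumUDst (freeComp (finGraph n m src tgt) v v' m' src' tgt') (inj₁ α) (inj₁ β) s t (a * b)
lemma4 n m src tgt α β n' m' src' tgt' v v' _ _ _ s t _ a b countG countG′ =
  count-++ countG countG′ (λ xs ys → Labelled.split xs ys α β s t)
  where open FreeComposition (finGraph n m src tgt) searchFin v v' src' tgt'
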